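{- There exist at least $17$ pairwise distinct sets $S$ of positive integers such that: $|S| = 47$; every element of $S$ is of the form $pq$ with $p<q$ prime numbers; and $\sum_{x\in S} \frac{1}{x} = 1$.
   Context: Equivalently, there are at least 17 distinct solutions of $\sum_{i=1}^{47} \frac{1}{x_i} = 1$ with $6 \le x_1 < x_2 < \dots < x_{47}$, where each $x_i = p_i q_i$ for primes $p_i < q_i$. -}

module Defs where

open import Data.Nat using (ℕ; zero; suc; _<_; _*_)
open import Data.Nat.Primality using (Prime)
open import Data.Integer using (+_)
open import Data.Rational using (ℚ; _/_; 0ℚ; 1ℚ) renaming (_+_ to _+ℚ_)
open import Data.List using (List; []; _∷_; length)
open import Data.List.Relation.Unary.All using (All)
open import Data.List.Relation.Unary.Linked using (Linked)
open import Data.Product using (Σ; ∃; ∃-syntax; _×_)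
open import Relation.Binary.PropositionalEquality using (_≡_)

-- reciprocal of a natural number as a rational; 1/0 is set to 0
-- (irrelevant here: all elements considered are of the form p*q ≥ 6)
recip : ℕ → ℚ
recip zero    = 0ℚ
recip (suc n) = + 1 / suc n

sumRecip : List ℕ → ℚ
sumRecip []       = 0ℚ
sumRecip (x ∷ xs) = recip x +ℚ sumRecip xs

IsSemiprimePQ : ℕ → Set
IsSemiprimePQ x = ∃[ p ] ∃[ q ] (Prime p × Prime q × p < q × x ≡ p * q)

-- a finite set of positive integers, represented canonically as a strictly
-- increasing list, meeting the requirements of the theorem
GoodSet : List ℕ → Set
GoodSet S = Linked _<_ S × length S ≡ 47 × All IsSemiprimePQ S × sumRecip S ≡ 1ℚ

module Submission where

-- Each of the seventeen sets is given by the factor pairs (p, q) of its elements.  Stated on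
-- the pairs, all requirements are decidable, so the certificates are checked by evaluation.

open import Defs
open import Data.Nat using (ℕ; _*_; _<_; _<?_; _≟_)
open import Data.Nat.Primality using (Prime; prime?)
open import Data.Rational using (1ℚ) renaming (_≟_ to _≟ℚ_)
open import Data.List using (List; []; _∷_; map; length)
open import Data.List.Properties using (length-map; ≡-dec)
open import Data.List.Relation.Unary.All as All using (All)
open import Data.List.Relation.Unary.All.Properties as All using ()
open import Data.List.Relation.Unary.Linked using (Linked; linked?)
open import Data.Vec as Vec using (Vec; []; _∷_; lookup)
open import Data.Vec.Relation.Unary.All as VecAll using ()
open import Data.Vec.Relation.Unary.All.Properties as VecAll using ()
open import Data.Vec.Relation.Unary.AllPairs using (allPairs?)
open import Data.Vec.Relation.Unary.Unique.Propositional using (Unique)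
open import Data.Vec.Relation.Unary.Unique.Propositional.Properties using (lookup-injective)
open import Data.Fin using (Fin)
open import Data.Product using (Σ; _×_; _,_; uncurry)
open import Function.Definitions using (Injective)
open import Relation.Binary.PropositionalEquality using (_≡_; refl; trans)
open import Relation.Nullary using (¬?)
open import Relation.Nullary.Decidable using (_×-dec_; toWitness)
open import Relation.Unary using (Decidable)

PrimePair : ℕ × ℕ → Set
PrimePair (p , q) = Prime p × Prime q × p < q

primePair? : Decidable PrimePair
primePair? (p , q) = prime? p ×-dec prime? q ×-dec p <? q

products : List (ℕ × ℕ) → List ℕ
products = map (uncurry _*_)

primePair⇒semiprime : ∀ x → PrimePair x → IsSemiprimePQ (uncurry _*_ x)
primePair⇒semiprime (p , q) (prime-p , prime-q , p<q) = p , q , prime-p , prime-q , p<q , refl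

GoodFactorisation : List (ℕ × ℕ) → Set
GoodFactorisation ps =
  Linked _<_ (products ps) × length ps ≡ 47 × All PrimePair ps × sumRecip (products ps) ≡ 1ℚ

goodFactorisation? : Decidable GoodFactorisation
goodFactorisation? ps =
  linked? _<?_ (products ps) ×-dec length ps ≟ 47 ×-dec All.all? primePair? ps
    ×-dec sumRecip (products ps) ≟ℚ 1ℚ

goodFactorisation⇒goodSet : ∀ {ps} → GoodFactorisation ps → GoodSet (products ps)
goodFactorisation⇒goodSet {ps} (increasing , length≡47 , primePairs , sum≡1) =
  increasing , trans (length-map (uncurry _*_) ps) length≡47 ,
  All.map⁺ (All.map (primePair⇒semiprime _) primePairs) , sum≡1

factorisations : Vec (List (ℕ × ℕ)) 17
factorisations =
  ( (2 , 3) ∷ (2 , 5) ∷ (2 , 7) ∷ (3 , 5) ∷ (3 , 7) ∷ (2 , 11) ∷ (2 , 13) ∷ (3 , 11) ∷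
      (2 , 17) ∷ (5 , 7) ∷ (2 , 19) ∷ (3 , 13) ∷ (2 , 23) ∷ (3 , 17) ∷ (5 , 11) ∷ (3 , 19) ∷
      (2 , 29) ∷ (2 , 31) ∷ (5 , 13) ∷ (3 , 23) ∷ (2 , 37) ∷ (7 , 11) ∷ (2 , 41) ∷ (5 , 17) ∷
      (3 , 29) ∷ (7 , 13) ∷ (3 , 31) ∷ (5 , 19) ∷ (5 , 23) ∷ (7 , 17) ∷ (3 , 41) ∷ (3 , 43) ∷
      (7 , 19) ∷ (11 , 13) ∷ (5 , 29) ∷ (5 , 31) ∷ (11 , 17) ∷ (3 , 71) ∷ (13 , 17) ∷ (7 , 41) ∷
      (7 , 43) ∷ (13 , 43) ∷ (17 , 37) ∷ (11 , 71) ∷ (29 , 43) ∷ (37 , 43) ∷ (23 , 71) ∷ [] )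
  ∷ ( (2 , 3) ∷ (2 , 5) ∷ (2 , 7) ∷ (3 , 5) ∷ (3 , 7) ∷ (2 , 11) ∷ (2 , 13) ∷ (3 , 11) ∷
      (2 , 17) ∷ (5 , 7) ∷ (2 , 19) ∷ (3 , 13) ∷ (2 , 23) ∷ (3 , 17) ∷ (5 , 11) ∷ (3 , 19) ∷
      (2 , 29) ∷ (2 , 31) ∷ (5 , 13) ∷ (3 , 23) ∷ (2 , 37) ∷ (7 , 11) ∷ (2 , 41) ∷ (2 , 43) ∷
      (7 , 13) ∷ (3 , 31) ∷ (5 , 19) ∷ (3 , 37) ∷ (7 , 17) ∷ (2 , 61) ∷ (3 , 41) ∷ (7 , 19) ∷
      (11 , 13) ∷ (5 , 29) ∷ (5 , 31) ∷ (7 , 23) ∷ (3 , 61) ∷ (11 , 17) ∷ (7 , 37) ∷ (7 , 41) ∷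
      (13 , 23) ∷ (11 , 29) ∷ (11 , 43) ∷ (13 , 37) ∷ (13 , 43) ∷ (11 , 61) ∷ (37 , 43) ∷ [] )
  ∷ ( (2 , 3) ∷ (2 , 5) ∷ (2 , 7) ∷ (3 , 5) ∷ (3 , 7) ∷ (2 , 11) ∷ (2 , 13) ∷ (3 , 11) ∷
      (2 , 17) ∷ (5 , 7) ∷ (2 , 19) ∷ (3 , 13) ∷ (2 , 23) ∷ (3 , 17) ∷ (5 , 11) ∷ (3 , 19) ∷
      (2 , 29) ∷ (2 , 31) ∷ (5 , 13) ∷ (3 , 23) ∷ (2 , 37) ∷ (7 , 11) ∷ (5 , 17) ∷ (2 , 43) ∷
      (3 , 29) ∷ (7 , 13) ∷ (3 , 31) ∷ (2 , 47) ∷ (5 , 19) ∷ (3 , 37) ∷ (5 , 23) ∷ (7 , 17) ∷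
      (7 , 19) ∷ (3 , 47) ∷ (2 , 71) ∷ (5 , 29) ∷ (5 , 31) ∷ (11 , 17) ∷ (3 , 71) ∷ (11 , 47) ∷
      (17 , 37) ∷ (17 , 47) ∷ (29 , 43) ∷ (37 , 43) ∷ (23 , 71) ∷ (43 , 47) ∷ (37 , 71) ∷ [] )
  ∷ ( (2 , 3) ∷ (2 , 5) ∷ (2 , 7) ∷ (3 , 5) ∷ (3 , 7) ∷ (2 , 11) ∷ (2 , 13) ∷ (3 , 11) ∷
      (2 , 17) ∷ (5 , 7) ∷ (2 , 19) ∷ (3 , 13) ∷ (2 , 23) ∷ (3 , 17) ∷ (5 , 11) ∷ (3 , 19) ∷
      (2 , 29) ∷ (2 , 31) ∷ (5 , 13) ∷ (3 , 23) ∷ (2 , 37) ∷ (7 , 11) ∷ (2 , 43) ∷ (3 , 29) ∷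
      (7 , 13) ∷ (3 , 31) ∷ (2 , 47) ∷ (5 , 19) ∷ (3 , 37) ∷ (5 , 23) ∷ (2 , 59) ∷ (7 , 17) ∷
      (3 , 43) ∷ (7 , 19) ∷ (5 , 29) ∷ (5 , 31) ∷ (7 , 23) ∷ (5 , 37) ∷ (11 , 17) ∷ (7 , 47) ∷
      (11 , 47) ∷ (23 , 29) ∷ (23 , 37) ∷ (29 , 37) ∷ (23 , 59) ∷ (29 , 47) ∷ (43 , 59) ∷ [] )
  ∷ ( (2 , 3) ∷ (2 , 5) ∷ (2 , 7) ∷ (3 , 5) ∷ (3 , 7) ∷ (2 , 11) ∷ (2 , 13) ∷ (3 , 11) ∷
      (2 , 17) ∷ (5 , 7) ∷ (2 , 19) ∷ (3 , 13) ∷ (2 , 23) ∷ (3 , 17) ∷ (5 , 11) ∷ (3 , 19) ∷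
      (2 , 29) ∷ (2 , 31) ∷ (5 , 13) ∷ (3 , 23) ∷ (2 , 37) ∷ (2 , 41) ∷ (5 , 17) ∷ (2 , 43) ∷
      (3 , 29) ∷ (7 , 13) ∷ (3 , 31) ∷ (5 , 19) ∷ (2 , 53) ∷ (3 , 37) ∷ (3 , 41) ∷ (7 , 19) ∷
      (5 , 29) ∷ (5 , 31) ∷ (3 , 53) ∷ (5 , 37) ∷ (7 , 29) ∷ (5 , 43) ∷ (11 , 23) ∷ (5 , 53) ∷
      (7 , 41) ∷ (11 , 29) ∷ (17 , 29) ∷ (11 , 53) ∷ (17 , 43) ∷ (23 , 37) ∷ (29 , 37) ∷ [] )
  ∷ ( (2 , 3) ∷ (2 , 5) ∷ (2 , 7) ∷ (3 , 5) ∷ (3 , 7) ∷ (2 , 11) ∷ (2 , 13) ∷ (3 , 11) ∷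
      (2 , 17) ∷ (5 , 7) ∷ (2 , 19) ∷ (3 , 13) ∷ (2 , 23) ∷ (3 , 17) ∷ (5 , 11) ∷ (3 , 19) ∷
      (2 , 29) ∷ (2 , 31) ∷ (5 , 13) ∷ (3 , 23) ∷ (7 , 11) ∷ (2 , 41) ∷ (5 , 17) ∷ (2 , 43) ∷
      (3 , 29) ∷ (7 , 13) ∷ (3 , 31) ∷ (2 , 47) ∷ (5 , 19) ∷ (3 , 37) ∷ (5 , 23) ∷ (7 , 17) ∷
      (7 , 19) ∷ (3 , 47) ∷ (2 , 71) ∷ (5 , 31) ∷ (11 , 17) ∷ (5 , 41) ∷ (3 , 71) ∷ (5 , 47) ∷
      (17 , 29) ∷ (11 , 47) ∷ (29 , 47) ∷ (23 , 71) ∷ (41 , 43) ∷ (41 , 47) ∷ (37 , 71) ∷ [] )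
  ∷ ( (2 , 3) ∷ (2 , 5) ∷ (2 , 7) ∷ (3 , 5) ∷ (3 , 7) ∷ (2 , 11) ∷ (2 , 13) ∷ (3 , 11) ∷
      (2 , 17) ∷ (5 , 7) ∷ (2 , 19) ∷ (3 , 13) ∷ (2 , 23) ∷ (3 , 17) ∷ (5 , 11) ∷ (3 , 19) ∷
      (2 , 29) ∷ (2 , 31) ∷ (5 , 13) ∷ (3 , 23) ∷ (7 , 11) ∷ (2 , 41) ∷ (5 , 17) ∷ (2 , 43) ∷
      (3 , 29) ∷ (7 , 13) ∷ (3 , 31) ∷ (2 , 47) ∷ (5 , 19) ∷ (5 , 23) ∷ (7 , 17) ∷ (3 , 41) ∷
      (3 , 43) ∷ (7 , 19) ∷ (3 , 47) ∷ (2 , 71) ∷ (5 , 29) ∷ (5 , 31) ∷ (11 , 17) ∷ (11 , 47) ∷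
      (17 , 47) ∷ (17 , 71) ∷ (29 , 43) ∷ (23 , 71) ∷ (41 , 43) ∷ (43 , 47) ∷ (41 , 71) ∷ [] )
  ∷ ( (2 , 3) ∷ (2 , 5) ∷ (2 , 7) ∷ (3 , 5) ∷ (3 , 7) ∷ (2 , 11) ∷ (2 , 13) ∷ (3 , 11) ∷
      (2 , 17) ∷ (5 , 7) ∷ (2 , 19) ∷ (3 , 13) ∷ (2 , 23) ∷ (3 , 17) ∷ (5 , 11) ∷ (3 , 19) ∷
      (2 , 29) ∷ (2 , 31) ∷ (5 , 13) ∷ (3 , 23) ∷ (7 , 11) ∷ (2 , 41) ∷ (5 , 17) ∷ (2 , 43) ∷
      (3 , 29) ∷ (7 , 13) ∷ (3 , 31) ∷ (2 , 47) ∷ (5 , 19) ∷ (2 , 59) ∷ (7 , 17) ∷ (3 , 41) ∷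
      (3 , 43) ∷ (7 , 19) ∷ (5 , 31) ∷ (7 , 23) ∷ (11 , 17) ∷ (3 , 71) ∷ (7 , 41) ∷ (7 , 47) ∷
      (5 , 71) ∷ (17 , 29) ∷ (7 , 71) ∷ (11 , 47) ∷ (23 , 59) ∷ (29 , 47) ∷ (43 , 59) ∷ [] )
  ∷ ( (2 , 3) ∷ (2 , 5) ∷ (2 , 7) ∷ (3 , 5) ∷ (3 , 7) ∷ (2 , 11) ∷ (2 , 13) ∷ (3 , 11) ∷
      (2 , 17) ∷ (5 , 7) ∷ (2 , 19) ∷ (3 , 13) ∷ (2 , 23) ∷ (3 , 17) ∷ (5 , 11) ∷ (3 , 19) ∷
      (2 , 29) ∷ (2 , 31) ∷ (5 , 13) ∷ (3 , 23) ∷ (7 , 11) ∷ (2 , 41) ∷ (5 , 17) ∷ (2 , 43) ∷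
      (3 , 29) ∷ (7 , 13) ∷ (3 , 31) ∷ (2 , 47) ∷ (5 , 19) ∷ (2 , 59) ∷ (7 , 17) ∷ (3 , 41) ∷
      (7 , 19) ∷ (5 , 29) ∷ (5 , 31) ∷ (7 , 23) ∷ (11 , 17) ∷ (7 , 29) ∷ (5 , 43) ∷ (7 , 41) ∷
      (7 , 47) ∷ (17 , 29) ∷ (11 , 47) ∷ (29 , 43) ∷ (23 , 59) ∷ (29 , 47) ∷ (43 , 59) ∷ [] )
  ∷ ( (2 , 3) ∷ (2 , 5) ∷ (2 , 7) ∷ (3 , 5) ∷ (3 , 7) ∷ (2 , 11) ∷ (2 , 13) ∷ (3 , 11) ∷
      (2 , 17) ∷ (5 , 7) ∷ (2 , 19) ∷ (3 , 13) ∷ (2 , 23) ∷ (3 , 17) ∷ (5 , 11) ∷ (3 , 19) ∷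
      (2 , 29) ∷ (2 , 31) ∷ (5 , 13) ∷ (3 , 23) ∷ (7 , 11) ∷ (2 , 41) ∷ (5 , 17) ∷ (2 , 43) ∷
      (3 , 29) ∷ (3 , 31) ∷ (2 , 47) ∷ (5 , 19) ∷ (5 , 23) ∷ (2 , 59) ∷ (7 , 17) ∷ (3 , 41) ∷
      (3 , 43) ∷ (7 , 19) ∷ (3 , 47) ∷ (11 , 13) ∷ (5 , 29) ∷ (5 , 31) ∷ (7 , 41) ∷ (13 , 29) ∷
      (17 , 23) ∷ (19 , 29) ∷ (17 , 47) ∷ (19 , 47) ∷ (23 , 59) ∷ (29 , 47) ∷ (43 , 59) ∷ [] )
  ∷ ( (2 , 3) ∷ (2 , 5) ∷ (2 , 7) ∷ (3 , 5) ∷ (3 , 7) ∷ (2 , 11) ∷ (2 , 13) ∷ (3 , 11) ∷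
      (2 , 17) ∷ (5 , 7) ∷ (2 , 19) ∷ (3 , 13) ∷ (2 , 23) ∷ (3 , 17) ∷ (5 , 11) ∷ (3 , 19) ∷
      (2 , 29) ∷ (2 , 31) ∷ (5 , 13) ∷ (3 , 23) ∷ (7 , 11) ∷ (2 , 41) ∷ (5 , 17) ∷ (2 , 43) ∷
      (3 , 29) ∷ (3 , 31) ∷ (2 , 47) ∷ (5 , 19) ∷ (5 , 23) ∷ (2 , 59) ∷ (7 , 17) ∷ (3 , 41) ∷
      (3 , 43) ∷ (7 , 19) ∷ (11 , 13) ∷ (5 , 29) ∷ (5 , 31) ∷ (3 , 59) ∷ (7 , 41) ∷ (13 , 23) ∷
      (17 , 23) ∷ (19 , 29) ∷ (13 , 47) ∷ (17 , 47) ∷ (19 , 47) ∷ (29 , 59) ∷ (43 , 59) ∷ [] )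
  ∷ ( (2 , 3) ∷ (2 , 5) ∷ (2 , 7) ∷ (3 , 5) ∷ (3 , 7) ∷ (2 , 11) ∷ (2 , 13) ∷ (3 , 11) ∷
      (2 , 17) ∷ (5 , 7) ∷ (2 , 19) ∷ (3 , 13) ∷ (2 , 23) ∷ (3 , 17) ∷ (5 , 11) ∷ (3 , 19) ∷
      (2 , 29) ∷ (2 , 31) ∷ (5 , 13) ∷ (3 , 23) ∷ (7 , 11) ∷ (2 , 41) ∷ (5 , 17) ∷ (2 , 43) ∷
      (7 , 13) ∷ (3 , 31) ∷ (2 , 47) ∷ (5 , 19) ∷ (5 , 23) ∷ (7 , 17) ∷ (3 , 41) ∷ (7 , 19) ∷
      (3 , 47) ∷ (2 , 71) ∷ (11 , 13) ∷ (5 , 31) ∷ (7 , 29) ∷ (13 , 17) ∷ (5 , 47) ∷ (7 , 41) ∷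
      (13 , 23) ∷ (5 , 71) ∷ (13 , 29) ∷ (17 , 23) ∷ (13 , 43) ∷ (43 , 47) ∷ (29 , 71) ∷ [] )
  ∷ ( (2 , 3) ∷ (2 , 5) ∷ (2 , 7) ∷ (3 , 5) ∷ (3 , 7) ∷ (2 , 11) ∷ (2 , 13) ∷ (3 , 11) ∷
      (2 , 17) ∷ (5 , 7) ∷ (2 , 19) ∷ (3 , 13) ∷ (2 , 23) ∷ (3 , 17) ∷ (5 , 11) ∷ (3 , 19) ∷
      (2 , 29) ∷ (2 , 31) ∷ (5 , 13) ∷ (3 , 23) ∷ (7 , 11) ∷ (2 , 41) ∷ (5 , 17) ∷ (3 , 29) ∷
      (7 , 13) ∷ (3 , 31) ∷ (2 , 47) ∷ (5 , 19) ∷ (3 , 37) ∷ (5 , 23) ∷ (2 , 59) ∷ (7 , 17) ∷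
      (3 , 41) ∷ (7 , 19) ∷ (2 , 71) ∷ (5 , 31) ∷ (11 , 17) ∷ (3 , 71) ∷ (7 , 41) ∷ (5 , 59) ∷
      (7 , 47) ∷ (7 , 59) ∷ (17 , 29) ∷ (11 , 47) ∷ (29 , 47) ∷ (23 , 71) ∷ (37 , 71) ∷ [] )
  ∷ ( (2 , 3) ∷ (2 , 5) ∷ (2 , 7) ∷ (3 , 5) ∷ (3 , 7) ∷ (2 , 11) ∷ (2 , 13) ∷ (3 , 11) ∷
      (2 , 17) ∷ (5 , 7) ∷ (2 , 19) ∷ (3 , 13) ∷ (2 , 23) ∷ (3 , 17) ∷ (5 , 11) ∷ (3 , 19) ∷
      (2 , 29) ∷ (2 , 31) ∷ (5 , 13) ∷ (3 , 23) ∷ (7 , 11) ∷ (2 , 41) ∷ (2 , 43) ∷ (3 , 29) ∷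
      (7 , 13) ∷ (3 , 31) ∷ (2 , 47) ∷ (5 , 19) ∷ (2 , 59) ∷ (7 , 17) ∷ (3 , 41) ∷ (3 , 43) ∷
      (7 , 19) ∷ (5 , 29) ∷ (5 , 31) ∷ (7 , 23) ∷ (3 , 59) ∷ (11 , 17) ∷ (7 , 29) ∷ (7 , 41) ∷
      (13 , 23) ∷ (7 , 47) ∷ (13 , 29) ∷ (11 , 47) ∷ (29 , 47) ∷ (29 , 59) ∷ (43 , 59) ∷ [] )
  ∷ ( (2 , 3) ∷ (2 , 5) ∷ (2 , 7) ∷ (3 , 5) ∷ (3 , 7) ∷ (2 , 11) ∷ (2 , 13) ∷ (3 , 11) ∷
      (2 , 17) ∷ (5 , 7) ∷ (2 , 19) ∷ (3 , 13) ∷ (2 , 23) ∷ (3 , 17) ∷ (5 , 11) ∷ (3 , 19) ∷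
      (2 , 29) ∷ (2 , 31) ∷ (5 , 13) ∷ (3 , 23) ∷ (7 , 11) ∷ (2 , 41) ∷ (2 , 43) ∷ (7 , 13) ∷
      (3 , 31) ∷ (2 , 47) ∷ (5 , 19) ∷ (3 , 37) ∷ (5 , 23) ∷ (7 , 17) ∷ (3 , 41) ∷ (7 , 19) ∷
      (3 , 47) ∷ (2 , 71) ∷ (11 , 13) ∷ (5 , 29) ∷ (5 , 31) ∷ (7 , 29) ∷ (3 , 71) ∷ (13 , 17) ∷
      (5 , 47) ∷ (7 , 41) ∷ (17 , 29) ∷ (13 , 43) ∷ (23 , 71) ∷ (43 , 47) ∷ (37 , 71) ∷ [] )
  ∷ ( (2 , 3) ∷ (2 , 5) ∷ (2 , 7) ∷ (3 , 5) ∷ (3 , 7) ∷ (2 , 11) ∷ (2 , 13) ∷ (3 , 11) ∷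
      (2 , 17) ∷ (5 , 7) ∷ (2 , 19) ∷ (3 , 13) ∷ (2 , 23) ∷ (3 , 17) ∷ (5 , 11) ∷ (3 , 19) ∷
      (2 , 29) ∷ (2 , 31) ∷ (5 , 13) ∷ (3 , 23) ∷ (7 , 11) ∷ (2 , 41) ∷ (3 , 29) ∷ (7 , 13) ∷
      (3 , 31) ∷ (5 , 19) ∷ (2 , 53) ∷ (3 , 37) ∷ (5 , 23) ∷ (7 , 17) ∷ (2 , 61) ∷ (3 , 41) ∷
      (7 , 19) ∷ (2 , 71) ∷ (5 , 31) ∷ (3 , 53) ∷ (3 , 61) ∷ (11 , 17) ∷ (7 , 29) ∷ (3 , 71) ∷
      (5 , 53) ∷ (7 , 41) ∷ (11 , 29) ∷ (11 , 53) ∷ (11 , 61) ∷ (23 , 71) ∷ (37 , 71) ∷ [] )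
  ∷ ( (2 , 3) ∷ (2 , 5) ∷ (2 , 7) ∷ (3 , 5) ∷ (3 , 7) ∷ (2 , 11) ∷ (2 , 13) ∷ (3 , 11) ∷
      (2 , 17) ∷ (5 , 7) ∷ (2 , 19) ∷ (3 , 13) ∷ (2 , 23) ∷ (3 , 17) ∷ (5 , 11) ∷ (3 , 19) ∷
      (2 , 29) ∷ (2 , 31) ∷ (5 , 13) ∷ (2 , 37) ∷ (7 , 11) ∷ (2 , 41) ∷ (5 , 17) ∷ (3 , 29) ∷
      (7 , 13) ∷ (3 , 31) ∷ (5 , 19) ∷ (3 , 37) ∷ (5 , 23) ∷ (7 , 17) ∷ (3 , 41) ∷ (3 , 43) ∷
      (7 , 19) ∷ (11 , 13) ∷ (5 , 29) ∷ (5 , 31) ∷ (7 , 23) ∷ (13 , 17) ∷ (11 , 23) ∷ (7 , 37) ∷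
      (7 , 41) ∷ (13 , 23) ∷ (17 , 23) ∷ (11 , 43) ∷ (13 , 37) ∷ (29 , 43) ∷ (37 , 43) ∷ [] )
  ∷ []

solutions : Vec (List ℕ) 17
solutions = Vec.map products factorisations

solutions-good : VecAll.All GoodSet solutions
solutions-good = VecAll.map⁺ (VecAll.map goodFactorisation⇒goodSet
  (toWitness {a? = VecAll.all? goodFactorisation? factorisations} _))

solutions-distinct : Unique solutions
solutions-distinct = toWitness {a? = allPairs? (λ xs ys → ¬? (≡-dec _≟_ xs ys)) solutions} _

mainTheorem1 : Σ (Fin 17 → List ℕ) (λ S → Injective _≡_ _≡_ S × ((i : Fin 17) → GoodSet (S i)))
mainTheorem1 =
  lookup solutions , lookup-injective solutions-distinct _ _ , VecAll.lookup⁺ solutions-good
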